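{- Let $G$ be a tree on $n$ vertices. Then there is a caterpillar tree $G'$ on $n$ vertices such that $\rho(G')-r(G')\leq \rho(G)-r(G)$.
   Context: Graphs have $n\geq2$ vertices. A caterpillar tree is a tree in which every vertex lies on a diametric path or is adjacent to a vertex of it (equivalently, removing all leaves yields a path); paths are caterpillars. $d(u,v)$ is the length of a shortest $u$–$v$ path; $e(v)=\max_u d(v,u)$; radius $r(G)=\min_v e(v)$. The normalized transmission of $v$ is $\pi(v)=\frac{1}{n-1}\sum_u d(v,u)$ and the remoteness is $\rho(G)=\max_v\pi(v)$. -}

module Defs where

open import Data.Bool using (Bool; true; false; _∧_; _∨_; if_then_else_)
open import Data.Nat using (ℕ; zero; suc; _+_; _⊔_; _⊓_; _<_)
open import Data.Fin using (Fin; zero; suc; toℕ; _≟_)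
open import Data.Fin.Properties using () renaming (_≟_ to _≟F_)
open import Data.Product using (Σ; ∃; _×_; _,_)
open import Data.Sum using (_⊎_)
open import Data.Integer using (+_)
open import Data.Rational as ℚ using (ℚ)
open import Function using (_∘_)
open import Function.Definitions using (Injective)
open import Relation.Binary.PropositionalEquality using (_≡_)
open import Relation.Nullary.Decidable using (⌊_⌋)

record Graph (n : ℕ) : Set where
  field
    adj   : Fin n → Fin n → Bool
    sym   : ∀ u v → adj u v ≡ adj v u
    irrfl : ∀ v → adj v v ≡ false
open Graph public

anyF : ∀ {n} → (Fin n → Bool) → Bool
anyF {zero}  f = false
anyF {suc n} f = f zero ∨ anyF (f ∘ suc)

sumF : ∀ {n} → (Fin n → ℕ) → ℕ
sumF {zero}  f = 0
sumF {suc n} f = f zero + sumF (f ∘ suc)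

maxF : ∀ {n} → (Fin n → ℕ) → ℕ
maxF {zero}  f = 0
maxF {suc n} f = f zero ⊔ maxF (f ∘ suc)

minF : ∀ {n} → (Fin (suc n) → ℕ) → ℕ
minF {zero}  f = f zero
minF {suc n} f = f zero ⊓ minF (f ∘ suc)

maxQ : ∀ {n} → (Fin (suc n) → ℚ) → ℚ
maxQ {zero}  f = f zero
maxQ {suc n} f = f zero ℚ.⊔ maxQ (f ∘ suc)

-- reach G k u v : there is a walk from u to v of length at most k
reach : ∀ {n} → Graph n → ℕ → Fin n → Fin n → Bool
reach G zero    u v = ⌊ u ≟F v ⌋
reach G (suc k) u v = reach G k u v ∨ anyF (λ w → adj G u w ∧ reach G k w v)

-- least k ≤ bound with reach G k u v (returns bound if none; irrelevant for connected graphs)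
firstReach : ∀ {n} → Graph n → Fin n → Fin n → ℕ → ℕ → ℕ
firstReach G u v k zero = k
firstReach G u v k (suc fuel) = if reach G k u v then k else firstReach G u v (suc k) fuel

-- d(u,v): the length of a shortest u–v walk (for connected graphs on n vertices it is ≤ n - 1)
dist : ∀ {n} → Graph n → Fin n → Fin n → ℕ
dist {n} G u v = firstReach G u v 0 n

-- Connected: every pair of vertices is joined by a walk (of length ≤ n, which is no restriction)
Connected : ∀ {n} → Graph n → Set
Connected {n} G = ∀ u v → reach G n u v ≡ true

edgeCount : ∀ {n} → Graph n → ℕ
edgeCount G = sumF (λ u → sumF (λ v → if ⌊ toℕ u Data.Nat.<? toℕ v ⌋ ∧ adj G u v then 1 else 0))
  where import Data.Nat

IsTree : ∀ {n} → Graph (suc n) → Set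
IsTree {n} G = Connected G × edgeCount G ≡ n

ecc : ∀ {n} → Graph n → Fin n → ℕ
ecc G v = maxF (λ u → dist G v u)

radius : ∀ {n} → Graph (suc n) → ℕ
radius G = minF (ecc G)

diameter : ∀ {n} → Graph n → ℕ
diameter G = maxF (ecc G)

-- transmission and normalized transmission π(v) = (1/(n-1)) Σ_u d(v,u), for n = m + 2
transmission : ∀ {n} → Graph n → Fin n → ℕ
transmission G v = sumF (λ u → dist G v u)

normTrans : ∀ {m} → Graph (suc (suc m)) → Fin (suc (suc m)) → ℚ
normTrans {m} G v = (+ transmission G v) ℚ./ suc m

remoteness : ∀ {m} → Graph (suc (suc m)) → ℚ
remoteness G = maxQ (normTrans G)

IsPath : ∀ {n} → Graph n → (k : ℕ) → (Fin (suc k) → Fin n) → Set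
IsPath G k p = Injective _≡_ _≡_ p
             × (∀ (i : Fin k) → adj G (p (Data.Fin.inject₁ i)) (p (suc i)) ≡ true)
  where import Data.Fin

-- A caterpillar: a tree with a diametric path (a path whose length equals the diameter;
-- in a tree every path is the unique, hence shortest, path between its ends) such that
-- every vertex lies on it or is adjacent to a vertex of it.
IsCaterpillar : ∀ {n} → Graph (suc n) → Set
IsCaterpillar {n} G =
  IsTree G ×
  Σ ℕ λ k → Σ (Fin (suc k) → Fin (suc n)) λ p →
    IsPath G k p × k ≡ diameter G ×
    (∀ v → (Σ (Fin (suc k)) λ i → p i ≡ v) ⊎ (Σ (Fin (suc k)) λ i → adj G v (p i) ≡ true))

-- Let n = m + 2 and δ = 1 if n is odd, δ = 0 otherwise; both sides are compared with δ/(m + 1).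
--
-- Lower bound, for a tree G of radius r: take u, u′ at distance d = diameter. Every vertex w has
-- d(u,w) + d(w,u′) ≥ d, with equality exactly on the d + 1 vertices of the u–u′ path and, a tree being
-- bipartite, at least d + 2 elsewhere. Summing, t(u) + t(u′) ≥ n(d + 2) − 2(d + 1) for the
-- transmissions t. The vertex of that path at distance ⌊d/2⌋ from u has eccentricity ⌈d/2⌉, so
-- 2r ≤ d + 1, and then t(u) or t(u′) is at least (m + 1)r + δ: ρ(G) − r(G) ≥ δ/(m + 1).
--
-- Upper bound: the path on n vertices (n even or n = 3), and for odd n ≥ 5 the path on n − 1 vertices
-- with a pendant vertex at a central vertex, has radius at least some R and all transmissions at most
-- (m + 1)R + δ, so there ρ − r ≤ δ/(m + 1).
module Submission where

open import Defs hiding (sym)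
open import Data.Bool using (Bool; true; false; _∧_; _∨_; not; if_then_else_)
open import Data.Bool.Properties using (∧-zeroʳ; not-¬)
open import Data.Empty using (⊥; ⊥-elim)
open import Data.Fin using (Fin; zero; suc; toℕ; fromℕ; fromℕ<; inject₁)
open import Data.Fin.Properties using (toℕ-injective; toℕ-fromℕ; toℕ-fromℕ<; toℕ-inject₁; toℕ<n; toℕ≤pred[n]; pigeonhole)
  renaming (_≟_ to _≟ᶠ_)
import Data.Fin.Properties as Fin
import Data.Integer as ℤ
import Data.Integer.Properties as ℤ
open import Data.Nat using (ℕ; zero; suc; _+_; _*_; _∸_; _≤_; _<_; z≤n; s≤s; _⊔_; _⊓_; _≟_; _≤?_; _<?_; ∣_-_∣; ⌊_/2⌋)
open import Data.Nat.Properties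
open import Data.Nat.Tactic.RingSolver using (solve-∀)
open import Data.Product using (Σ; _×_; _,_; proj₁; proj₂)
open import Data.Rational as ℚ using (ℚ; toℚᵘ)
import Data.Rational.Properties as ℚ
import Data.Rational.Unnormalised as ℚᵘ
import Data.Rational.Unnormalised.Properties as ℚᵘ
open import Data.Sum using (_⊎_; inj₁; inj₂)
open import Function using (_∘_)
open import Relation.Binary.Definitions using (tri<; tri≈; tri>)
open import Relation.Binary.PropositionalEquality using (_≡_; _≢_; refl; sym; trans; cong; cong₂; subst; subst₂; module ≡-Reasoning)
open import Relation.Nullary using (¬_; Dec; yes; no)
open import Relation.Nullary.Decidable using (⌊_⌋; _×-dec_; _⊎-dec_)

∨-true-elim : ∀ a b → a ∨ b ≡ true → a ≡ true ⊎ b ≡ true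
∨-true-elim true  b p = inj₁ refl
∨-true-elim false b p = inj₂ p

∧-true-elim : ∀ a b → a ∧ b ≡ true → a ≡ true × b ≡ true
∧-true-elim true true p = refl , refl

∨-true-introˡ : ∀ a b → a ≡ true → a ∨ b ≡ true
∨-true-introˡ true b p = refl

∨-true-introʳ : ∀ a b → b ≡ true → a ∨ b ≡ true
∨-true-introʳ true  b p = refl
∨-true-introʳ false b p = p

∧-true-intro : ∀ a b → a ≡ true → b ≡ true → a ∧ b ≡ true
∧-true-intro true true p q = refl

true≢false : true ≢ false
true≢false ()

isYes-true⇒ : ∀ {A : Set} (a? : Dec A) → ⌊ a? ⌋ ≡ true → A
isYes-true⇒ (yes a) p = a

isYes-true : ∀ {A : Set} (a? : Dec A) → A → ⌊ a? ⌋ ≡ true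
isYes-true (yes _) a = refl
isYes-true (no ¬a) a = ⊥-elim (¬a a)

isYes-false : ∀ {A : Set} (a? : Dec A) → ¬ A → ⌊ a? ⌋ ≡ false
isYes-false (yes a) ¬a = ⊥-elim (¬a a)
isYes-false (no _)  ¬a = refl

isYes-cong : ∀ {A B : Set} (a? : Dec A) (b? : Dec B) → (A → B) → (B → A) → ⌊ a? ⌋ ≡ ⌊ b? ⌋
isYes-cong (yes a) (yes b) f g = refl
isYes-cong (yes a) (no ¬b) f g = ⊥-elim (¬b (f a))
isYes-cong (no ¬a) (yes b) f g = ⊥-elim (¬a (g b))
isYes-cong (no ¬a) (no ¬b) f g = refl

anyF-true-elim : ∀ {n} (f : Fin n → Bool) → anyF f ≡ true → Σ (Fin n) λ w → f w ≡ true
anyF-true-elim {suc n} f p with ∨-true-elim (f zero) (anyF (f ∘ suc)) p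
... | inj₁ q = zero , q
... | inj₂ q with anyF-true-elim (f ∘ suc) q
... | w , r = suc w , r

anyF-true-intro : ∀ {n} (f : Fin n → Bool) w → f w ≡ true → anyF f ≡ true
anyF-true-intro f zero    p = ∨-true-introˡ _ _ p
anyF-true-intro f (suc w) p = ∨-true-introʳ (f zero) _ (anyF-true-intro (f ∘ suc) w p)

bit : Bool → ℕ
bit b = if b then 1 else 0

bit≤1 : ∀ b → bit b ≤ 1
bit≤1 true  = ≤-refl
bit≤1 false = z≤n

bit-∧-split : ∀ a b → bit a ≡ bit (a ∧ not b) + bit (a ∧ b)
bit-∧-split true  true  = refl
bit-∧-split true  false = refl
bit-∧-split false b     = refl

even : ℕ → Bool
even zero          = true
even (suc zero)    = false
even (suc (suc n)) = even n

even-suc : ∀ n → even (suc n) ≡ not (even n)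
even-suc zero          = refl
even-suc (suc zero)    = refl
even-suc (suc (suc n)) = even-suc n

even-double : ∀ a → even (a + a) ≡ true
even-double zero    = refl
even-double (suc a) rewrite +-suc a a = even-double a

even-double+1 : ∀ a → even (suc (a + a)) ≡ false
even-double+1 zero    = refl
even-double+1 (suc a) rewrite +-suc a a = even-double+1 a

halve : ∀ d → Σ ℕ λ a → d ≡ a + a ⊎ d ≡ suc (a + a)
halve zero          = 0 , inj₁ refl
halve (suc zero)    = 0 , inj₂ refl
halve (suc (suc d)) with halve d
... | a , inj₁ refl = suc a , inj₁ (cong suc (sym (+-suc a a)))
... | a , inj₂ refl = suc a , inj₂ (cong (λ x → suc (suc x)) (sym (+-suc a a)))

sumF-cong : ∀ {n} {f g : Fin n → ℕ} → (∀ v → f v ≡ g v) → sumF f ≡ sumF g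
sumF-cong {zero}  h = refl
sumF-cong {suc n} h = cong₂ _+_ (h zero) (sumF-cong (h ∘ suc))

sumF-mono : ∀ {n} {f g : Fin n → ℕ} → (∀ v → f v ≤ g v) → sumF f ≤ sumF g
sumF-mono {zero}  h = z≤n
sumF-mono {suc n} h = +-mono-≤ (h zero) (sumF-mono (h ∘ suc))

sumF-mono-< : ∀ {n} {f g : Fin n → ℕ} → (∀ v → f v ≤ g v) → ∀ v → f v < g v → sumF f < sumF g
sumF-mono-< h zero    lt = +-mono-<-≤ lt (sumF-mono (h ∘ suc))
sumF-mono-< h (suc v) lt = +-mono-≤-< (h zero) (sumF-mono-< (h ∘ suc) v lt)

sumF-distrib-+ : ∀ {n} (f g : Fin n → ℕ) → sumF (λ v → f v + g v) ≡ sumF f + sumF g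
sumF-distrib-+ {zero}  f g = refl
sumF-distrib-+ {suc n} f g rewrite sumF-distrib-+ (f ∘ suc) (g ∘ suc) =
  +-comm-middle (f zero) (g zero) (sumF (f ∘ suc)) (sumF (g ∘ suc))
  where
  +-comm-middle : ∀ a b c d → a + b + (c + d) ≡ a + c + (b + d)
  +-comm-middle = solve-∀

sumF-const : ∀ {n} c → sumF {n} (λ _ → c) ≡ n * c
sumF-const {zero}  c = refl
sumF-const {suc n} c = cong (c +_) (sumF-const {n} c)

sumF-zero : ∀ {n} (f : Fin n → ℕ) → (∀ v → f v ≡ 0) → sumF f ≡ 0
sumF-zero {n} f h = trans (sumF-cong h) (trans (sumF-const {n} 0) (*-zeroʳ n))

sumF-*ˡ : ∀ {n} c (f : Fin n → ℕ) → sumF (λ v → c * f v) ≡ c * sumF f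
sumF-*ˡ {zero}  c f = sym (*-zeroʳ c)
sumF-*ˡ {suc n} c f rewrite sumF-*ˡ c (f ∘ suc) = sym (*-distribˡ-+ c (f zero) (sumF (f ∘ suc)))

sumF-swap : ∀ {m n} (f : Fin m → Fin n → ℕ) → sumF (λ u → sumF (f u)) ≡ sumF (λ v → sumF (λ u → f u v))
sumF-swap {zero}  {n} f = sym (sumF-zero {n} _ (λ _ → refl))
sumF-swap {suc m} f = trans (cong (sumF (f zero) +_) (sumF-swap (f ∘ suc)))
                            (sym (sumF-distrib-+ (f zero) (λ v → sumF (λ u → f (suc u) v))))

term≤sumF : ∀ {n} (f : Fin n → ℕ) v → f v ≤ sumF f
term≤sumF f zero    = m≤m+n _ _
term≤sumF f (suc v) = ≤-trans (term≤sumF (f ∘ suc) v) (m≤n+m _ _)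

two-terms≤sumF : ∀ {n} (f : Fin n → ℕ) v w → v ≢ w → f v + f w ≤ sumF f
two-terms≤sumF f zero    zero    v≢w = ⊥-elim (v≢w refl)
two-terms≤sumF f zero    (suc w) v≢w = +-monoʳ-≤ (f zero) (term≤sumF (f ∘ suc) w)
two-terms≤sumF f (suc v) zero    v≢w =
  subst (_≤ sumF f) (+-comm (f zero) (f (suc v))) (+-monoʳ-≤ (f zero) (term≤sumF (f ∘ suc) v))
two-terms≤sumF f (suc v) (suc w) v≢w =
  ≤-trans (two-terms≤sumF (f ∘ suc) v w (v≢w ∘ cong suc)) (m≤n+m _ _)

sumF-bit-≢ : ∀ {n} (s : Fin (suc n)) → sumF (λ v → bit (not ⌊ v ≟ᶠ s ⌋)) ≡ n
sumF-bit-≢ {n}     zero    = trans (sumF-const {n} 1) (*-identityʳ n)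
sumF-bit-≢ {suc n} (suc s) = cong suc (trans (sumF-cong {suc n} step) (sumF-bit-≢ s))
  where
  step : ∀ v → bit (not ⌊ suc v ≟ᶠ suc s ⌋) ≡ bit (not ⌊ v ≟ᶠ s ⌋)
  step v with v ≟ᶠ s
  ... | yes refl = refl
  ... | no _     = refl

count-unique≤1 : ∀ {n} (g : Fin n → Bool) → (∀ v w → g v ≡ true → g w ≡ true → v ≡ w) → sumF (bit ∘ g) ≤ 1
count-unique≤1 {zero}  g unique = z≤n
count-unique≤1 {suc n} g unique with g zero in g0
... | true  = ≤-reflexive (cong suc (sumF-zero (bit ∘ g ∘ suc) none))
  where
  none : ∀ w → bit (g (suc w)) ≡ 0
  none w with g (suc w) in gw
  ... | true  with unique zero (suc w) g0 gw
  ... | ()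
  none w | false = refl
... | false = count-unique≤1 (g ∘ suc) (λ v w p q → Fin.suc-injective (unique (suc v) (suc w) p q))

count-injective≤ : ∀ {n} B (g : Fin n → Bool) (f : Fin n → ℕ) → (∀ w → g w ≡ true → f w < B) →
                   (∀ v w → g v ≡ true → g w ≡ true → f v ≡ f w → v ≡ w) → sumF (bit ∘ g) ≤ B
count-injective≤ zero g f bounded inj = ≤-reflexive (sumF-zero (bit ∘ g) none)
  where
  none : ∀ w → bit (g w) ≡ 0
  none w with g w in gw
  ... | true with bounded w gw
  ... | ()
  none w | false = refl
count-injective≤ {n} (suc B) g f bounded inj = begin
  sumF (bit ∘ g)                              ≡⟨ sumF-cong (λ w → bit-∧-split (g w) (hitsB w)) ⟩
  sumF (λ w → bit (below w) + bit (atB w))     ≡⟨ sumF-distrib-+ (bit ∘ below) (bit ∘ atB) ⟩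
  sumF (bit ∘ below) + sumF (bit ∘ atB)        ≤⟨ +-mono-≤ (count-injective≤ B below f bounded′ inj′) (count-unique≤1 atB unique) ⟩
  B + 1                                        ≡⟨ +-comm B 1 ⟩
  suc B                                        ∎
  where
  open ≤-Reasoning
  hitsB below atB : Fin n → Bool
  hitsB w = ⌊ f w ≟ B ⌋
  below w = g w ∧ not (hitsB w)
  atB   w = g w ∧ hitsB w
  bounded′ : ∀ w → below w ≡ true → f w < B
  bounded′ w p with ∧-true-elim (g w) _ p
  ... | gw , q with f w ≟ B
  ... | no f≢B = ≤∧≢⇒< (≤-pred (bounded w gw)) f≢B
  inj′ : ∀ v w → below v ≡ true → below w ≡ true → f v ≡ f w → v ≡ w
  inj′ v w p q = inj v w (proj₁ (∧-true-elim (g v) _ p)) (proj₁ (∧-true-elim (g w) _ q))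
  unique : ∀ v w → atB v ≡ true → atB w ≡ true → v ≡ w
  unique v w p q with ∧-true-elim (g v) _ p | ∧-true-elim (g w) _ q
  ... | gv , hv | gw , hw = inj v w gv gw (trans (isYes-true⇒ (f v ≟ B) hv) (sym (isYes-true⇒ (f w ≟ B) hw)))

maxF-ub : ∀ {n} (f : Fin n → ℕ) v → f v ≤ maxF f
maxF-ub f zero    = m≤m⊔n _ _
maxF-ub f (suc v) = ≤-trans (maxF-ub (f ∘ suc) v) (m≤n⊔m _ _)

maxF-lub : ∀ {n} (f : Fin n → ℕ) b → (∀ v → f v ≤ b) → maxF f ≤ b
maxF-lub {zero}  f b h = z≤n
maxF-lub {suc n} f b h = ⊔-lub (h zero) (maxF-lub (f ∘ suc) b (h ∘ suc))

maxF-attained : ∀ {n} (f : Fin (suc n) → ℕ) → Σ (Fin (suc n)) λ v → maxF f ≡ f v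
maxF-attained {zero}  f = zero , ⊔-identityʳ (f zero)
maxF-attained {suc n} f with ⊔-sel (f zero) (maxF (f ∘ suc))
... | inj₁ e = zero , e
... | inj₂ e with maxF-attained (f ∘ suc)
... | v , e′ = suc v , trans e e′

minF-lb : ∀ {n} (f : Fin (suc n) → ℕ) v → minF f ≤ f v
minF-lb {zero}  f zero    = ≤-refl
minF-lb {suc n} f zero    = m⊓n≤m _ _
minF-lb {suc n} f (suc v) = ≤-trans (m⊓n≤n _ _) (minF-lb (f ∘ suc) v)

minF-glb : ∀ {n} (f : Fin (suc n) → ℕ) b → (∀ v → b ≤ f v) → b ≤ minF f
minF-glb {zero}  f b h = h zero
minF-glb {suc n} f b h = ⊓-glb (h zero) (minF-glb (f ∘ suc) b (h ∘ suc))

maxQ-ub : ∀ {n} (f : Fin (suc n) → ℚ) v → f v ℚ.≤ maxQ f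
maxQ-ub {zero}  f zero    = ℚ.≤-refl
maxQ-ub {suc n} f zero    = ℚ.p≤p⊔q (f zero) _
maxQ-ub {suc n} f (suc v) = ℚ.≤-trans (maxQ-ub (f ∘ suc) v) (ℚ.p≤q⊔p (f zero) _)

maxQ-lub : ∀ {n} (f : Fin (suc n) → ℚ) q → (∀ v → f v ℚ.≤ q) → maxQ f ℚ.≤ q
maxQ-lub {zero}  f q h = h zero
maxQ-lub {suc n} f q h = ℚ.⊔-lub (h zero) (maxQ-lub (f ∘ suc) q (h ∘ suc))

half-ceiling : ∀ d r → (∀ a → a ≤ d → r ≤ (d ∸ a) ⊔ a) → r + r ≤ suc d
half-ceiling d r bound with halve d
... | a , inj₁ refl = ≤-trans (+-mono-≤ r≤a r≤a) (n≤1+n (a + a))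
  where
  r≤a : r ≤ a
  r≤a = subst (r ≤_) (trans (cong (_⊔ a) (m+n∸n≡m a a)) (⊔-idem a)) (bound a (m≤m+n a a))
... | a , inj₂ refl = subst (r + r ≤_) (+-suc (suc a) a) (+-mono-≤ r≤1+a r≤1+a)
  where
  r≤1+a : r ≤ suc a
  r≤1+a = subst (r ≤_) (trans (cong (_⊔ a) (m+n∸n≡m (suc a) a)) (m≥n⇒m⊔n≡m (n≤1+n a)))
                (bound a (≤-trans (m≤m+n a a) (n≤1+n _)))

at-least-half : ∀ y t₁ t₂ → 2 * y ≤ t₁ + t₂ + 1 → y ≤ t₁ ⊎ y ≤ t₂
at-least-half y t₁ t₂ h with y ≤? t₁ | y ≤? t₂
... | yes y≤t₁ | _        = inj₁ y≤t₁
... | no _     | yes y≤t₂ = inj₂ y≤t₂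
... | no y≰t₁  | no y≰t₂  =
  ⊥-elim (1+n≰n (≤-trans (subst₂ _≤_ (both t₁ t₂) (double y) (+-mono-≤ (≰⇒> y≰t₁) (≰⇒> y≰t₂))) h))
  where
  both : ∀ t₁ t₂ → suc t₁ + suc t₂ ≡ suc (t₁ + t₂ + 1)
  both = solve-∀
  double : ∀ y → y + y ≡ 2 * y
  double = solve-∀

half≤ : ∀ {r b} → r + r ≤ suc (b + b) → r ≤ b
half≤ {r} {b} h = ≮⇒≥ λ b<r → 1+n≰n (≤-trans (subst (_≤ r + r) (cong suc (+-suc b b)) (+-mono-≤ b<r b<r)) h)

half≤suc : ∀ {r b} → r + r ≤ suc (suc (b + b)) → r ≤ suc b
half≤suc {b = b} h = half≤ (≤-trans h (s≤s (s≤s (+-monoʳ-≤ b (n≤1+n b)))))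

budget-mono : ∀ N r δ {a c} C → r ≤ a → δ ≤ c → 2 * (N * r + δ) + C ≤ 2 * (N * a + c) + C
budget-mono N r δ C r≤a δ≤c = +-monoˡ-≤ C (*-monoʳ-≤ 2 (+-mono-≤ (*-monoʳ-≤ N r≤a) δ≤c))

-- With N = d + e, each parity case is an identity exhibiting a nonnegative slack.
transmission-budget : ∀ N d r → 1 ≤ d → d ≤ N → r + r ≤ suc d →
                      2 * (N * r + bit (even N)) + 2 * suc d ≤ suc N * (d + 2) + 1
transmission-budget N d r 1≤d d≤N 2r≤d+1 with halve d | m≤n⇒∃[o]m+o≡n d≤N
... | zero   , inj₁ refl | _ = ⊥-elim (1+n≰n 1≤d)
... | suc a′ , inj₁ refl | e , refl =
  ≤-trans (budget-mono N r (bit (even N)) (2 * suc d) (half≤ {b = suc a′} 2r≤d+1) (bit≤1 (even N)))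
          (≤-trans (m≤m+n _ (2 * a′ + 2 * e + 1)) (≤-reflexive (sym (identity a′ e))))
  where
  identity : ∀ a′ e → let a = suc a′ ; d = a + a ; N = d + e in
             suc N * (d + 2) + 1 ≡ 2 * (N * a + 1) + 2 * suc d + (2 * a′ + 2 * e + 1)
  identity = solve-∀
... | a , inj₂ refl | zero , refl =
  ≤-trans (budget-mono N r (bit (even N)) (2 * suc d) (half≤suc 2r≤d+1) (≤-reflexive N-odd))
          (≤-trans (m≤m+n _ 1) (≤-reflexive (sym (identity a))))
  where
  N-odd : bit (even (suc (a + a) + 0)) ≡ 0
  N-odd rewrite +-identityʳ (suc (a + a)) | even-double+1 a = refl
  identity : ∀ a → let d = suc (a + a) ; N = d + 0 in
             suc N * (d + 2) + 1 ≡ 2 * (N * suc a + 0) + 2 * suc d + 1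
  identity = solve-∀
... | a , inj₂ refl | suc e′ , refl =
  ≤-trans (budget-mono N r (bit (even N)) (2 * suc d) (half≤suc 2r≤d+1) (bit≤1 (even N)))
          (≤-trans (m≤m+n _ e′) (≤-reflexive (sym (identity a e′))))
  where
  identity : ∀ a e′ → let d = suc (a + a) ; N = d + suc e′ in
             suc N * (d + 2) + 1 ≡ 2 * (N * suc a + 1) + 2 * suc d + e′
  identity = solve-∀

-- Distances in connected graphs

module Distance {n} (G : Graph n) (conn : Connected G) where

  D : Fin n → Fin n → ℕ
  D = dist G

  adj-sym : ∀ {u w} → adj G u w ≡ true → adj G w u ≡ true
  adj-sym {u} {w} a = trans (sym (Graph.sym G u w)) a

  firstReach-spec : ∀ u v k fuel → reach G (k + fuel) u v ≡ true → (∀ j → j < k → reach G j u v ≡ false) →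
                    reach G (firstReach G u v k fuel) u v ≡ true × (∀ j → j < firstReach G u v k fuel → reach G j u v ≡ false)
  firstReach-spec u v k zero p below rewrite +-identityʳ k = p , below
  firstReach-spec u v k (suc fuel) p below with reach G k u v in rk
  ... | true  = rk , below
  ... | false = firstReach-spec u v (suc k) fuel (subst (λ x → reach G x u v ≡ true) (+-suc k fuel) p) below′
    where
    below′ : ∀ j → j < suc k → reach G j u v ≡ false
    below′ j (s≤s j≤k) with m≤n⇒m<n∨m≡n j≤k
    ... | inj₁ j<k  = below j j<k
    ... | inj₂ refl = rk

  dist-reaches : ∀ u v → reach G (D u v) u v ≡ true
  dist-reaches u v = proj₁ (firstReach-spec u v 0 n (conn u v) (λ _ ()))

  reach⇒dist≤ : ∀ {k} u v → reach G k u v ≡ true → D u v ≤ k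
  reach⇒dist≤ {k} u v p with D u v ≤? k
  ... | yes q = q
  ... | no q  = ⊥-elim (true≢false (trans (sym p) (proj₂ (firstReach-spec u v 0 n (conn u v) (λ _ ())) k (≰⇒> q))))

  dist≡0⇒≡ : ∀ {u v} → D u v ≡ 0 → u ≡ v
  dist≡0⇒≡ {u} {v} p with u ≟ᶠ v | subst (λ x → reach G x u v ≡ true) p (dist-reaches u v)
  ... | yes u≡v | _ = u≡v
  ... | no _    | ()

  dist-refl : ∀ u → D u u ≡ 0
  dist-refl u = n≤0⇒n≡0 (reach⇒dist≤ {0} u u (isYes-true (u ≟ᶠ u) refl))

  dist-adjˡ : ∀ {u w} v → adj G u w ≡ true → D u v ≤ suc (D w v)
  dist-adjˡ {u} {w} v a = reach⇒dist≤ u v (∨-true-introʳ (reach G (D w v) u v) _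
    (anyF-true-intro (λ x → adj G u x ∧ reach G (D w v) x v) w (∧-true-intro _ _ a (dist-reaches w v))))

  dist-step : ∀ {u v k} → D u v ≡ suc k → Σ (Fin n) λ w → adj G u w ≡ true × D w v ≡ k
  dist-step {u} {v} {k} eq with dist-reaches u v
  ... | r rewrite eq with ∨-true-elim (reach G k u v) _ r
  ... | inj₁ q = ⊥-elim (1+n≰n (subst (_≤ k) eq (reach⇒dist≤ u v q)))
  ... | inj₂ q with anyF-true-elim _ q
  ... | w , aw with ∧-true-elim _ _ aw
  ... | a , rw = w , a , ≤-antisym (reach⇒dist≤ w v rw) (≤-pred (subst (_≤ suc (D w v)) eq (dist-adjˡ v a)))

  dist-triangle : ∀ x y z → D x z ≤ D x y + D y z
  dist-triangle x y z = go (D x y) x refl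
    where
    go : ∀ k x → D x y ≡ k → D x z ≤ k + D y z
    go zero    x eq rewrite dist≡0⇒≡ eq = ≤-refl
    go (suc k) x eq with dist-step eq
    ... | w , a , e = ≤-trans (dist-adjˡ z a) (s≤s (go k w e))

  adj⇒dist≤1 : ∀ {u w} → adj G u w ≡ true → D u w ≤ 1
  adj⇒dist≤1 {u} {w} a = subst (λ x → D u w ≤ suc x) (dist-refl w) (dist-adjˡ w a)

  dist-sym : ∀ x y → D x y ≡ D y x
  dist-sym x y = ≤-antisym (sym≤ y x) (sym≤ x y)
    where
    sym≤ : ∀ x y → D y x ≤ D x y
    sym≤ x y = go (D x y) x refl
      where
      go : ∀ k x → D x y ≡ k → D y x ≤ k
      go zero    x eq rewrite dist≡0⇒≡ eq | dist-refl y = ≤-refl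
      go (suc k) x eq with dist-step eq
      ... | w , a , e = ≤-trans (dist-triangle y w x)
                          (subst (D y w + D w x ≤_) (+-comm k 1) (+-mono-≤ (go k w e) (adj⇒dist≤1 (adj-sym a))))

  dist-adjʳ : ∀ {u w} v → adj G u w ≡ true → D v u ≤ suc (D v w)
  dist-adjʳ {u} {w} v a = subst₂ _≤_ (dist-sym u v) (cong suc (dist-sym w v)) (dist-adjˡ v a)

-- Trees

Tournament : ∀ {n} → (Fin n → Fin n → Bool) → Set
Tournament R = ∀ u v → u ≢ v → R u v ≡ not (R v u)

double-injective : ∀ {a b} → a + a ≡ b + b → a ≡ b
double-injective {a} {b} e = trans (n≡⌊n+n/2⌋ a) (trans (cong ⌊_/2⌋ e) (sym (n≡⌊n+n/2⌋ b)))

module Orientation {n} (G : Graph n) where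

  arcs : (Fin n → Fin n → Bool) → ℕ
  arcs R = sumF (λ u → sumF (λ v → bit (R u v ∧ adj G u v)))

  arcs-double : ∀ R → Tournament R → arcs R + arcs R ≡ sumF (λ u → sumF (λ v → bit (adj G u v)))
  arcs-double R t = begin
    arcs R + arcs R                                    ≡⟨ cong (arcs R +_) reversed ⟩
    sumF (sumF ∘ forward) + sumF (sumF ∘ backward)      ≡⟨ sym (sumF-distrib-+ (sumF ∘ forward) (sumF ∘ backward)) ⟩
    sumF (λ u → sumF (forward u) + sumF (backward u))   ≡⟨ sumF-cong (λ u → sym (sumF-distrib-+ (forward u) (backward u))) ⟩
    sumF (λ u → sumF (λ v → forward u v + backward u v)) ≡⟨ sumF-cong (λ u → sumF-cong (one-direction u)) ⟩
    sumF (λ u → sumF (λ v → bit (adj G u v)))           ∎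
    where
    open ≡-Reasoning
    forward backward : Fin n → Fin n → ℕ
    forward  u v = bit (R u v ∧ adj G u v)
    backward u v = bit (R v u ∧ adj G u v)
    reversed : arcs R ≡ sumF (sumF ∘ backward)
    reversed = trans (sumF-cong (λ u → sumF-cong (λ v → cong (λ x → bit (R u v ∧ x)) (Graph.sym G u v))))
                     (sumF-swap (λ u v → bit (R u v ∧ adj G v u)))
    one-direction : ∀ u v → forward u v + backward u v ≡ bit (adj G u v)
    one-direction u v with u ≟ᶠ v
    ... | yes refl rewrite irrfl G u | ∧-zeroʳ (R u u) = refl
    ... | no u≢v rewrite t u v u≢v with R v u | adj G u v
    ... | true  | true  = refl
    ... | true  | false = refl
    ... | false | true  = refl
    ... | false | false = refl

  indexOrder : Fin n → Fin n → Bool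
  indexOrder u v = ⌊ toℕ u <? toℕ v ⌋

  indexOrder-tournament : Tournament indexOrder
  indexOrder-tournament u v u≢v with toℕ u <? toℕ v | toℕ v <? toℕ u
  ... | yes u<v | yes v<u = ⊥-elim (<-asym u<v v<u)
  ... | yes _   | no _    = refl
  ... | no _    | yes _   = refl
  ... | no u≮v  | no v≮u  = ⊥-elim (u≢v (toℕ-injective (≤-antisym (≮⇒≥ v≮u) (≮⇒≥ u≮v))))

  arcs≡edgeCount : ∀ R → Tournament R → arcs R ≡ edgeCount G
  arcs≡edgeCount R t = double-injective (trans (arcs-double R t) (sym (arcs-double indexOrder indexOrder-tournament)))

module Tree {N} (G : Graph (suc N)) (tree : IsTree G) where
  open Distance G (proj₁ tree) public
  open Orientation G

  -- Orient each edge towards the endpoint of larger level, ties broken by index. There are N arcs and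
  -- every non-root vertex receives one from a BFS parent, so each receives exactly one: parents are
  -- unique and no edge joins two vertices of the same level.
  module Rooted (s : Fin (suc N)) where

    level : Fin (suc N) → ℕ
    level = D s

    before : Fin (suc N) → Fin (suc N) → Bool
    before u v = ⌊ level u <? level v ⌋ ∨ (⌊ level u ≟ level v ⌋ ∧ indexOrder u v)

    before-tournament : Tournament before
    before-tournament u v u≢v with level u <? level v | level v <? level u | level u ≟ level v | level v ≟ level u
    ... | yes u<v | yes v<u | _       | _        = ⊥-elim (<-asym u<v v<u)
    ... | yes _   | no _    | _       | no _     = refl
    ... | yes u<v | no _    | _       | yes v≡u  = ⊥-elim (<-irrefl (sym v≡u) u<v)
    ... | no _    | yes _   | no _    | _        = refl
    ... | no _    | yes v<u | yes u≡v | _        = ⊥-elim (<-irrefl (sym u≡v) v<u)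
    ... | no _    | no _    | yes _   | yes _    = indexOrder-tournament u v u≢v
    ... | no u≮v  | no v≮u  | no u≢v′ | _        = ⊥-elim (u≢v′ (≤-antisym (≮⇒≥ v≮u) (≮⇒≥ u≮v)))
    ... | no _    | no _    | yes u≡v | no v≢u   = ⊥-elim (v≢u (sym u≡v))

    before-lower : ∀ {u v} → level u < level v → before u v ≡ true
    before-lower {u} {v} lt = ∨-true-introˡ _ _ (isYes-true (level u <? level v) lt)

    inArc : Fin (suc N) → Fin (suc N) → ℕ
    inArc u v = bit (before u v ∧ adj G u v)

    inArc≡1 : ∀ {u v} → before u v ≡ true → adj G u v ≡ true → inArc u v ≡ 1
    inArc≡1 p a rewrite p | a = refl

    inDegree : Fin (suc N) → ℕ
    inDegree v = sumF (λ u → inArc u v)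

    sumF-inDegree : sumF inDegree ≡ N
    sumF-inDegree = trans (sym (sumF-swap inArc)) (trans (arcs≡edgeCount before before-tournament) (proj₂ tree))

    parent : ∀ v → v ≢ s → Σ (Fin (suc N)) λ p → adj G p v ≡ true × level v ≡ suc (level p)
    parent v v≢s with D s v in eq
    ... | zero  = ⊥-elim (v≢s (sym (dist≡0⇒≡ eq)))
    ... | suc k with dist-step {v} {s} {k} (trans (dist-sym v s) eq)
    ... | p , a , e = p , adj-sym a , cong suc (sym (trans (dist-sym s p) e))

    inDegree≥1 : ∀ v → v ≢ s → 1 ≤ inDegree v
    inDegree≥1 v v≢s with parent v v≢s
    ... | p , a , e = subst (_≤ inDegree v) (inArc≡1 (before-lower (≤-reflexive (sym e))) a) (term≤sumF (λ u → inArc u v) p)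

    inDegree≤1 : ∀ v → v ≢ s → inDegree v ≤ 1
    inDegree≤1 v v≢s = ≮⇒≥ λ 1<deg → <-irrefl (sym sumF-inDegree) (subst (_< sumF inDegree) (sumF-bit-≢ s)
                                         (sumF-mono-< nonRoot≤inDegree v (subst (_< inDegree v) (sym (nonRoot v v≢s)) 1<deg)))
      where
      nonRoot : ∀ w → w ≢ s → bit (not ⌊ w ≟ᶠ s ⌋) ≡ 1
      nonRoot w w≢s rewrite isYes-false (w ≟ᶠ s) w≢s = refl
      nonRoot≤inDegree : ∀ w → bit (not ⌊ w ≟ᶠ s ⌋) ≤ inDegree w
      nonRoot≤inDegree w with w ≟ᶠ s
      ... | yes _   = z≤n
      ... | no w≢s  = inDegree≥1 w w≢s

    single-inArc : ∀ {v u₁ u₂} → v ≢ s → u₁ ≢ u₂ → before u₁ v ≡ true → adj G u₁ v ≡ true →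
                   before u₂ v ≡ true → adj G u₂ v ≡ true → ⊥
    single-inArc {v} {u₁} {u₂} v≢s u₁≢u₂ b₁ a₁ b₂ a₂ =
      1+n≰n (≤-trans (subst (_≤ inDegree v) (cong₂ _+_ (inArc≡1 b₁ a₁) (inArc≡1 b₂ a₂))
                                 (two-terms≤sumF (λ u → inArc u v) u₁ u₂ u₁≢u₂))
                     (inDegree≤1 v v≢s))

    parent-unique : ∀ {v p₁ p₂} → v ≢ s → adj G p₁ v ≡ true → adj G p₂ v ≡ true →
                    level p₁ < level v → level p₂ < level v → p₁ ≡ p₂
    parent-unique {v} {p₁} {p₂} v≢s a₁ a₂ l₁ l₂ with p₁ ≟ᶠ p₂
    ... | yes p₁≡p₂ = p₁≡p₂
    ... | no p₁≢p₂  = ⊥-elim (single-inArc v≢s p₁≢p₂ (before-lower l₁) a₁ (before-lower l₂) a₂)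

    adj⇒level≢ : ∀ {u v} → adj G u v ≡ true → level u ≢ level v
    adj⇒level≢ {u} {v} a e with u ≟ᶠ v
    ... | yes refl = true≢false (trans (sym a) (irrfl G u))
    ... | no u≢v with v ≟ᶠ s | u ≟ᶠ s
    ... | yes refl | _        = u≢v (sym (dist≡0⇒≡ (trans e (dist-refl _))))
    ... | no _     | yes refl = u≢v (dist≡0⇒≡ (trans (sym e) (dist-refl _)))
    ... | no v≢s   | no u≢s with before u v in buv
    ... | true with parent v v≢s
    ...   | p , ap , ep = single-inArc v≢s (λ p≡u → <-irrefl (cong level p≡u) (subst (level p <_) (sym e) (≤-reflexive (sym ep))))
                            (before-lower (≤-reflexive (sym ep))) ap buv a
    adj⇒level≢ {u} {v} a e | no u≢v | no v≢s | no u≢s | false with parent u u≢s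
    ...   | p , ap , ep = single-inArc u≢s (λ p≡v → <-irrefl (cong level p≡v) (subst (level p <_) e (≤-reflexive (sym ep))))
                            (before-lower (≤-reflexive (sym ep))) ap
                            (trans (before-tournament v u (u≢v ∘ sym)) (cong not buv)) (adj-sym a)

    adj⇒level-step : ∀ {u v} → adj G u v ≡ true → level v ≡ suc (level u) ⊎ level u ≡ suc (level v)
    adj⇒level-step {u} {v} a with <-cmp (level u) (level v)
    ... | tri≈ _ e _  = ⊥-elim (adj⇒level≢ a e)
    ... | tri< lt _ _ = inj₁ (≤-antisym (dist-adjʳ s (adj-sym a)) lt)
    ... | tri> _ _ gt = inj₂ (≤-antisym (dist-adjʳ s a) gt)

  even-detour : ∀ u w y → even (D u w + D w y) ≡ even (D u y)
  even-detour u w y = go (D w y) w refl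
    where
    go : ∀ k w → D w y ≡ k → even (D u w + k) ≡ even (D u y)
    go zero    w e rewrite dist≡0⇒≡ e | +-identityʳ (D u y) = refl
    go (suc j) w e with dist-step e
    ... | w′ , a , e′ with Rooted.adj⇒level-step u a
    ... | inj₁ l = trans (cong even (trans (+-suc (D u w) j) (cong (_+ j) (sym l)))) (go j w′ e′)
    ... | inj₂ l = trans (cong even (trans (cong (_+ suc j) l) (cong suc (+-suc (D u w′) j)))) (go j w′ e′)

  OnGeodesic : Fin (suc N) → Fin (suc N) → Fin (suc N) → Set
  OnGeodesic u u′ w = D u w + D w u′ ≡ D u u′

  onGeodesic-sym : ∀ {u u′ w} → OnGeodesic u u′ w → OnGeodesic u′ u w
  onGeodesic-sym {u} {u′} {w} g =
    trans (cong₂ _+_ (dist-sym u′ w) (dist-sym w u)) (trans (+-comm (D w u′) (D u w)) (trans g (dist-sym u u′)))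

  detour≢suc : ∀ u u′ w → D u w + D w u′ ≢ suc (D u u′)
  detour≢suc u u′ w e = not-¬ refl (trans (sym (even-detour u w u′)) (trans (cong even e) (even-suc (D u u′))))

  geodesic-step : ∀ {u u′ w j} → OnGeodesic u u′ w → D w u′ ≡ suc j →
                  Σ (Fin (suc N)) λ p → adj G w p ≡ true × D p u′ ≡ j × D u p ≡ suc (D u w) × OnGeodesic u u′ p
  geodesic-step {u} {u′} {w} {j} g e with dist-step e
  ... | p , a , e′ = p , a , e′ , level-p , trans (cong₂ _+_ level-p e′) (trans (sym (+-suc (D u w) j)) (trans (cong (D u w +_) (sym e)) g))
    where
    level-p : D u p ≡ suc (D u w)
    level-p = ≤-antisym (dist-adjʳ u (adj-sym a))
                (+-cancelʳ-≤ j (suc (D u w)) (D u p)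
                  (subst₂ _≤_ (trans (sym g) (trans (cong (D u w +_) e) (+-suc (D u w) j))) (cong (D u p +_) e′)
                    (dist-triangle u p u′)))

  geodesic-unique : ∀ {u u′ w₁ w₂} → OnGeodesic u u′ w₁ → OnGeodesic u u′ w₂ → D u w₁ ≡ D u w₂ → w₁ ≡ w₂
  geodesic-unique {u} {u′} {w₁} {w₂} g₁ g₂ l =
    go (D w₁ u′) w₁ w₂ refl same-rest g₁ g₂ l
    where
    same-rest : D w₂ u′ ≡ D w₁ u′
    same-rest = sym (+-cancelˡ-≡ (D u w₁) (D w₁ u′) (D w₂ u′) (trans g₁ (trans (sym g₂) (cong (_+ D w₂ u′) (sym l)))))
    go : ∀ j w₁ w₂ → D w₁ u′ ≡ j → D w₂ u′ ≡ j → OnGeodesic u u′ w₁ → OnGeodesic u u′ w₂ →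
         D u w₁ ≡ D u w₂ → w₁ ≡ w₂
    go zero    w₁ w₂ e₁ e₂ g₁ g₂ l = trans (dist≡0⇒≡ e₁) (sym (dist≡0⇒≡ e₂))
    go (suc j) w₁ w₂ e₁ e₂ g₁ g₂ l with geodesic-step g₁ e₁ | geodesic-step g₂ e₂
    ... | p₁ , a₁ , f₁ , l₁ , h₁ | p₂ , a₂ , f₂ , l₂ , h₂ =
      Rooted.parent-unique u p₁≢u a₁ (subst (λ x → adj G w₂ x ≡ true) (sym p₁≡p₂) a₂)
        (≤-reflexive (sym l₁)) (≤-reflexive (sym (trans (cong (D u) p₁≡p₂) l₂)))
      where
      p₁≡p₂ : p₁ ≡ p₂
      p₁≡p₂ = go j p₁ p₂ f₁ f₂ h₁ h₂ (trans l₁ (trans (cong suc l) (sym l₂)))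
      p₁≢u : p₁ ≢ u
      p₁≢u p₁≡u = 0≢1+n (trans (sym (trans (cong (D u) p₁≡u) (dist-refl u))) l₁)

  geodesic-vertex : ∀ u u′ i → i ≤ D u u′ → Σ (Fin (suc N)) λ w → OnGeodesic u u′ w × D u w ≡ i
  geodesic-vertex u u′ zero    _     = u , cong (_+ D u u′) (dist-refl u) , dist-refl u
  geodesic-vertex u u′ (suc i) i<d with geodesic-vertex u u′ i (≤-trans (n≤1+n i) i<d)
  ... | w , g , refl = next (D w u′) refl
    where
    next : ∀ k → D w u′ ≡ k → Σ (Fin (suc N)) λ p → OnGeodesic u u′ p × D u p ≡ suc (D u w)
    next zero    e = ⊥-elim (<-irrefl (trans (sym (+-identityʳ (D u w))) (trans (cong (D u w +_) (sym e)) g)) i<d)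
    next (suc j) e with geodesic-step g e
    ... | p , _ , _ , lp , gp = p , gp , lp

  -- If x reaches b through a neighbour a lying farther from u than b, it reaches u through b.
  dist-through : ∀ {u u′ a b x} → OnGeodesic u u′ b → adj G a b ≡ true → D u a ≡ suc (D u b) →
                 D x b ≡ suc (D x a) → D x u ≡ D x b + D u b
  dist-through {u} {u′} {a} {b} {x} g ab la xb = go (D u b) a b refl g ab la xb
    where
    go : ∀ j a b → D u b ≡ j → OnGeodesic u u′ b → adj G a b ≡ true → D u a ≡ suc j →
         D x b ≡ suc (D x a) → D x u ≡ D x b + j
    go zero    a b l g ab la xb rewrite dist≡0⇒≡ l = sym (+-identityʳ _)
    go (suc j) a b l g ab la xb with geodesic-step (onGeodesic-sym g) (trans (dist-sym b u) l)
    ... | c , bc , fc , _ , gc with Rooted.adj⇒level-step x bc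
    ... | inj₁ up = trans (go j b c (trans (dist-sym u c) fc) (onGeodesic-sym gc) bc l up)
                          (trans (cong (_+ j) up) (sym (+-suc (D x b) j)))
    ... | inj₂ dn = ⊥-elim (1+n≰n (≤-trans (n≤1+n (suc j)) (≤-reflexive two-steps)))
      where
      b≢x : b ≢ x
      b≢x b≡x = 0≢1+n (trans (sym (trans (cong (D x) b≡x) (dist-refl x))) xb)
      a≡c : a ≡ c
      a≡c = Rooted.parent-unique x b≢x ab (adj-sym bc) (≤-reflexive (sym xb)) (≤-reflexive (sym dn))
      two-steps : suc (suc j) ≡ j
      two-steps = trans (sym la) (trans (cong (D u) a≡c) (trans (dist-sym u c) fc))

  geodesic-separates : ∀ {u u′ c k j} → OnGeodesic u u′ c → D u c ≡ suc k → D c u′ ≡ suc j →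
                       ∀ x → D x u ≡ D x c + suc k ⊎ D x u′ ≡ D x c + suc j
  geodesic-separates {u} {u′} {c} {k} {j} g lc rc x
    with geodesic-step (onGeodesic-sym g) (trans (dist-sym c u) lc) | geodesic-step g rc
  ... | m , cm , fm , _ , gm | p , cp , fp , lp , gp with Rooted.adj⇒level-step x cm
  ... | inj₁ up = inj₁ (trans (dist-through (onGeodesic-sym gm) cm (trans lc (cong suc (sym (trans (dist-sym u m) fm)))) up)
                              (trans (cong₂ _+_ up (trans (dist-sym u m) fm)) (sym (+-suc (D x c) k))))
  ... | inj₂ dn with Rooted.adj⇒level-step x cp
  ... | inj₁ up = inj₂ (trans (dist-through (onGeodesic-sym gp) cp
                                 (trans (dist-sym u′ c) (trans rc (cong suc (sym (trans (dist-sym u′ p) fp))))) up)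
                              (trans (cong₂ _+_ up (trans (dist-sym u′ p) fp)) (sym (+-suc (D x c) j))))
  ... | inj₂ dn′ = ⊥-elim (1+n≰n (≤-trans (n≤1+n (suc k)) (≤-reflexive two-steps)))
    where
    c≢x : c ≢ x
    c≢x c≡x = 0≢1+n (trans (sym (trans (cong (D x) c≡x) (dist-refl x))) dn)
    m≡p : m ≡ p
    m≡p = Rooted.parent-unique x c≢x (adj-sym cm) (adj-sym cp) (≤-reflexive (sym dn)) (≤-reflexive (sym dn′))
    two-steps : suc (suc k) ≡ k
    two-steps = trans (sym (trans lp (cong suc lc))) (trans (cong (D u) (sym m≡p)) (trans (dist-sym u m) fm))

  onGeodesic? : Fin (suc N) → Fin (suc N) → Fin (suc N) → Bool
  onGeodesic? u u′ w = ⌊ D u w + D w u′ ≟ D u u′ ⌋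

  dist-sum≥ : ∀ u u′ w → D u u′ + 2 ≤ D u w + D u′ w + 2 * bit (onGeodesic? u u′ w)
  dist-sum≥ u u′ w rewrite dist-sym u′ w with D u w + D w u′ ≟ D u u′
  ... | yes g  = ≤-reflexive (cong (_+ 2) (sym g))
  ... | no ¬g  = subst₂ _≤_ (+-comm 2 (D u u′)) (sym (+-identityʳ _)) (two-more (dist-triangle u w u′))
    where
    two-more : D u u′ ≤ D u w + D w u′ → suc (suc (D u u′)) ≤ D u w + D w u′
    two-more ≥d with m≤n⇒m<n∨m≡n ≥d
    ... | inj₂ e = ⊥-elim (¬g (sym e))
    ... | inj₁ >d with m≤n⇒m<n∨m≡n >d
    ... | inj₂ e = ⊥-elim (detour≢suc u u′ w (sym e))
    ... | inj₁ >d+1 = >d+1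

  count-onGeodesic : ∀ u u′ → sumF (bit ∘ onGeodesic? u u′) ≤ suc (D u u′)
  count-onGeodesic u u′ = count-injective≤ (suc (D u u′)) (onGeodesic? u u′) (D u) bounded injective
    where
    bounded : ∀ w → onGeodesic? u u′ w ≡ true → D u w < suc (D u u′)
    bounded w g = s≤s (subst (D u w ≤_) (isYes-true⇒ (_ ≟ _) g) (m≤m+n _ _))
    injective : ∀ w₁ w₂ → onGeodesic? u u′ w₁ ≡ true → onGeodesic? u u′ w₂ ≡ true → D u w₁ ≡ D u w₂ → w₁ ≡ w₂
    injective w₁ w₂ g₁ g₂ = geodesic-unique (isYes-true⇒ (_ ≟ _) g₁) (isYes-true⇒ (_ ≟ _) g₂)

  transmission-pair : ∀ u u′ → suc N * (D u u′ + 2) ≤ transmission G u + transmission G u′ + 2 * suc (D u u′)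
  transmission-pair u u′ = begin
    suc N * (D u u′ + 2)                                          ≡⟨ sym (sumF-const {suc N} (D u u′ + 2)) ⟩
    sumF {suc N} (λ _ → D u u′ + 2)                               ≤⟨ sumF-mono (dist-sum≥ u u′) ⟩
    sumF (λ w → D u w + D u′ w + 2 * bit (onGeodesic? u u′ w))   ≡⟨ sumF-distrib-+ (λ w → D u w + D u′ w) (λ w → 2 * bit (onGeodesic? u u′ w)) ⟩
    sumF (λ w → D u w + D u′ w) + sumF (λ w → 2 * bit (onGeodesic? u u′ w))
                                                                  ≡⟨ cong₂ _+_ (sumF-distrib-+ (D u) (D u′)) (sumF-*ˡ 2 (bit ∘ onGeodesic? u u′)) ⟩
    transmission G u + transmission G u′ + 2 * sumF (bit ∘ onGeodesic? u u′)
                                                                  ≤⟨ +-monoʳ-≤ (transmission G u + transmission G u′) (*-monoʳ-≤ 2 (count-onGeodesic u u′)) ⟩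
    transmission G u + transmission G u′ + 2 * suc (D u u′)       ∎
    where open ≤-Reasoning

  vertexAt : ∀ u u′ (i : Fin (suc (D u u′))) → Σ (Fin (suc N)) λ w → OnGeodesic u u′ w × D u w ≡ toℕ i
  vertexAt u u′ i = geodesic-vertex u u′ (toℕ i) (toℕ≤pred[n] i)

  dist≤N : ∀ u u′ → D u u′ ≤ N
  dist≤N u u′ with D u u′ ≤? N
  ... | yes d≤N = d≤N
  ... | no d≰N with pigeonhole (s≤s (≰⇒> d≰N)) (proj₁ ∘ vertexAt u u′)
  ... | i , j , i<j , same = ⊥-elim (<-irrefl (trans (sym (at i)) (trans (cong (D u) same) (at j))) i<j)
    where
    at : ∀ i → D u (proj₁ (vertexAt u u′ i)) ≡ toℕ i
    at i = proj₂ (proj₂ (vertexAt u u′ i))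

  module Diametral (u u′ : Fin (suc N)) (diametral : ∀ y z → D y z ≤ D u u′) where

    ecc-onGeodesic : ∀ {c} → OnGeodesic u u′ c → ∀ x → D c x ≤ (D u u′ ∸ D u c) ⊔ D u c
    ecc-onGeodesic {c} g x = split (D u c) refl (D c u′) refl
      where
      split : ∀ k → D u c ≡ k → ∀ j → D c u′ ≡ j → D c x ≤ (D u u′ ∸ k) ⊔ k
      split zero    lc _       _  rewrite sym (dist≡0⇒≡ lc) = m≤n⇒m≤n⊔o 0 (diametral u x)
      split (suc k) lc zero    rc = m≤n⇒m≤o⊔n (D u u′ ∸ suc k)
        (subst₂ _≤_ (cong (λ y → D y x) (sym (dist≡0⇒≡ rc))) (trans (sym g) (trans (cong₂ _+_ lc rc) (+-identityʳ (suc k))))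
          (diametral u′ x))
      split (suc k) lc (suc j) rc with geodesic-separates g lc rc x
      ... | inj₁ via-u  = m≤n⇒m≤n⊔o (suc k) (subst (_≤ D u u′ ∸ suc k) (trans (m+n∸n≡m (D x c) (suc k)) (dist-sym x c))
                            (∸-monoˡ-≤ (suc k) (subst (_≤ D u u′) via-u (diametral x u))))
      ... | inj₂ via-u′ = m≤n⇒m≤o⊔n (D u u′ ∸ suc k) (subst (_≤ suc k) (dist-sym x c) (+-cancelʳ-≤ (suc j) (D x c) (suc k)
                            (subst₂ _≤_ via-u′ (trans (sym g) (cong₂ _+_ lc rc)) (diametral x u′))))

    radius-half : radius G + radius G ≤ suc (D u u′)
    radius-half = half-ceiling (D u u′) (radius G) bound
      where
      bound : ∀ a → a ≤ D u u′ → radius G ≤ (D u u′ ∸ a) ⊔ a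
      bound a a≤d with geodesic-vertex u u′ a a≤d
      ... | c , g , refl = ≤-trans (minF-lb (ecc G) c) (maxF-lub (dist G c) _ (ecc-onGeodesic g))

    double-bound≤transmission-pair : 1 ≤ D u u′ →
                                     2 * (N * radius G + bit (even N)) ≤ transmission G u + transmission G u′ + 1
    double-bound≤transmission-pair 1≤d = +-cancelʳ-≤ C _ _ (begin
      2 * (N * radius G + bit (even N)) + C          ≤⟨ transmission-budget N d (radius G) 1≤d (dist≤N u u′) radius-half ⟩
      suc N * (d + 2) + 1                           ≤⟨ +-monoˡ-≤ 1 (transmission-pair u u′) ⟩
      transmission G u + transmission G u′ + C + 1  ≡⟨ +-swap-last (transmission G u + transmission G u′) C 1 ⟩
      transmission G u + transmission G u′ + 1 + C  ∎)
      where
      open ≤-Reasoning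
      d = D u u′
      C = 2 * suc d
      +-swap-last : ∀ x y z → x + y + z ≡ x + z + y
      +-swap-last = solve-∀

    max-transmission≥ : 1 ≤ D u u′ → Σ (Fin (suc N)) λ v → N * radius G + bit (even N) ≤ transmission G v
    max-transmission≥ 1≤d with at-least-half _ (transmission G u) (transmission G u′) (double-bound≤transmission-pair 1≤d)
    ... | inj₁ at-u  = u , at-u
    ... | inj₂ at-u′ = u′ , at-u′

diametral-pair : ∀ {n} (G : Graph (suc n)) → Σ (Fin (suc n)) λ u → Σ (Fin (suc n)) λ u′ → ∀ y z → dist G y z ≤ dist G u u′
diametral-pair G with maxF-attained (ecc G)
... | u , eu with maxF-attained (dist G u)
... | u′ , eu′ = u , u′ , λ y z → ≤-trans (maxF-ub (dist G y) z) (≤-trans (maxF-ub (ecc G) y) (≤-reflexive (trans eu eu′)))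

transmission-lower-bound : ∀ m (G : Graph (suc (suc m))) → IsTree G →
                           Σ (Fin (suc (suc m))) λ v → suc m * radius G + bit (even (suc m)) ≤ transmission G v
transmission-lower-bound m G tree =
  let u , u′ , diametral = diametral-pair G
  in  Diametral.max-transmission≥ u u′ diametral (≤-trans (n≢0⇒n>0 (Fin.0≢1+n ∘ dist≡0⇒≡)) (diametral zero (suc zero)))
  where open Tree G tree

-- Graphs with an explicit metric

fromRelation : ∀ n {R : ℕ → ℕ → Set} → (∀ x y → Dec (R x y)) → (∀ {x y} → R x y → R y x) → (∀ {x} → ¬ R x x) →
               Graph n
fromRelation n R? R-sym R-irrefl = record
  { adj   = λ u v → ⌊ R? (toℕ u) (toℕ v) ⌋
  ; sym   = λ u v → isYes-cong (R? _ _) (R? _ _) R-sym R-sym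
  ; irrfl = λ v → isYes-false (R? _ _) R-irrefl
  }

module GraphMetric {n} {R : ℕ → ℕ → Set} (R? : ∀ x y → Dec (R x y))
                   (R-sym : ∀ {x y} → R x y → R y x) (R-irrefl : ∀ {x} → ¬ R x x)
                   (metric : ℕ → ℕ → ℕ)
                   (metric≡0⇒≡ : ∀ {x y} → metric x y ≡ 0 → x ≡ y)
                   (metric-refl : ∀ x → metric x x ≡ 0)
                   (metric-adj : ∀ {x w} y → R x w → metric x y ≤ suc (metric w y))
                   (metric-step : ∀ {x y k} → x < n → y < n → metric x y ≡ suc k → Σ ℕ λ w → w < n × R x w × metric w y ≡ k)
                   (metric-bound : ∀ {x y} → x < n → y < n → metric x y ≤ n) where

  G : Graph n
  G = fromRelation n R? R-sym R-irrefl

  reach⇒metric≤ : ∀ k u v → reach G k u v ≡ true → metric (toℕ u) (toℕ v) ≤ k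
  reach⇒metric≤ zero u v p with u ≟ᶠ v
  ... | yes refl = ≤-reflexive (metric-refl (toℕ u))
  reach⇒metric≤ (suc k) u v p with ∨-true-elim (reach G k u v) _ p
  ... | inj₁ q = ≤-trans (reach⇒metric≤ k u v q) (n≤1+n k)
  ... | inj₂ q with anyF-true-elim _ q
  ... | w , r with ∧-true-elim _ _ r
  ... | a , r′ = ≤-trans (metric-adj (toℕ v) (isYes-true⇒ (R? _ _) a)) (s≤s (reach⇒metric≤ k w v r′))

  metric≤⇒reach : ∀ k u v → metric (toℕ u) (toℕ v) ≤ k → reach G k u v ≡ true
  metric≤⇒reach zero u v p = isYes-true (u ≟ᶠ v) (toℕ-injective (metric≡0⇒≡ (n≤0⇒n≡0 p)))
  metric≤⇒reach (suc k) u v p with m≤n⇒m<n∨m≡n p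
  ... | inj₁ q = ∨-true-introˡ _ _ (metric≤⇒reach k u v (≤-pred q))
  ... | inj₂ q with metric-step (toℕ<n u) (toℕ<n v) q
  ... | w , w<n , r , e = ∨-true-introʳ (reach G k u v) _
          (anyF-true-intro _ (fromℕ< w<n) (∧-true-intro _ _
             (isYes-true (R? _ _) (subst (R (toℕ u)) (sym (toℕ-fromℕ< w<n)) r))
             (metric≤⇒reach k (fromℕ< w<n) v (≤-reflexive (trans (cong (λ z → metric z (toℕ v)) (toℕ-fromℕ< w<n)) e)))))

  connected : Connected G
  connected u v = metric≤⇒reach n u v (metric-bound (toℕ<n u) (toℕ<n v))

  dist≡metric : ∀ u v → dist G u v ≡ metric (toℕ u) (toℕ v)
  dist≡metric u v = ≤-antisym (reach⇒dist≤ u v (metric≤⇒reach _ u v ≤-refl)) (reach⇒metric≤ _ u v (dist-reaches u v))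
    where open Distance G connected

sumN : ℕ → (ℕ → ℕ) → ℕ
sumN zero    g = 0
sumN (suc n) g = g 0 + sumN n (g ∘ suc)

sumF-toℕ : ∀ {n} (g : ℕ → ℕ) → sumF {n} (g ∘ toℕ) ≡ sumN n g
sumF-toℕ {zero}  g = refl
sumF-toℕ {suc n} g = cong (g 0 +_) (sumF-toℕ {n} (g ∘ suc))

sumN-cong : ∀ n {g h : ℕ → ℕ} → (∀ j → j < n → g j ≡ h j) → sumN n g ≡ sumN n h
sumN-cong zero    e = refl
sumN-cong (suc n) e = cong₂ _+_ (e 0 (s≤s z≤n)) (sumN-cong n (λ j j<n → e (suc j) (s≤s j<n)))

sumN-const : ∀ n c → sumN n (λ _ → c) ≡ n * c
sumN-const zero    c = refl
sumN-const (suc n) c = cong (c +_) (sumN-const n c)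

sumN-suc : ∀ n (g : ℕ → ℕ) → sumN n (λ j → suc (g j)) ≡ n + sumN n g
sumN-suc zero    g = refl
sumN-suc (suc n) g = cong suc (trans (cong (g 0 +_) (sumN-suc n (g ∘ suc))) (+-comm-left (g 0) n _))
  where
  +-comm-left : ∀ a b c → a + (b + c) ≡ b + (a + c)
  +-comm-left = solve-∀

tri : ℕ → ℕ
tri zero    = 0
tri (suc k) = suc k + tri k

tri-+ : ∀ i k → tri (i + k) ≡ tri i + tri k + i * k
tri-+ zero    k = sym (+-identityʳ (tri k))
tri-+ (suc i) k rewrite tri-+ i k = shuffle i k (tri i) (tri k)
  where
  shuffle : ∀ i k a b → suc (i + k + (a + b + i * k)) ≡ suc (i + a) + b + suc i * k
  shuffle = solve-∀

tri-double : ∀ k → tri k + tri k ≡ k * suc k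
tri-double zero    = refl
tri-double (suc k) = trans (regroup k (tri k)) (trans (cong (2 * suc k +_) (tri-double k)) (expand k))
  where
  regroup : ∀ k t → suc k + t + (suc k + t) ≡ 2 * suc k + (t + t)
  regroup = solve-∀
  expand : ∀ k → 2 * suc k + k * suc k ≡ suc k * suc (suc k)
  expand = solve-∀

tri-odd : ∀ a → tri (suc (a + a)) ≡ suc a * suc (a + a)
tri-odd a = double-injective (trans (tri-double (suc (a + a))) (expand a))
  where
  expand : ∀ a → suc (a + a) * suc (suc (a + a)) ≡ suc a * suc (a + a) + suc a * suc (a + a)
  expand = solve-∀

sumN-id : ∀ k → sumN (suc k) (λ j → j) ≡ tri k
sumN-id zero    = refl
sumN-id (suc k) = trans (sumN-suc (suc k) (λ j → j)) (cong (suc k +_) (sumN-id k))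

sumN-∣-∣ : ∀ i k → sumN (i + suc k) (λ j → ∣ i - j ∣) ≡ tri i + tri k
sumN-∣-∣ zero    k = sumN-id k
sumN-∣-∣ (suc i) k = trans (cong (suc i +_) (sumN-∣-∣ i k)) (sym (+-assoc (suc i) (tri i) (tri k)))

sumN-∣-∣≤tri : ∀ {i K} → i ≤ K → sumN (suc K) (λ j → ∣ i - j ∣) ≤ tri K
sumN-∣-∣≤tri {i} i≤K with m≤n⇒∃[o]m+o≡n i≤K
... | k , refl = begin
  sumN (suc (i + k)) (λ j → ∣ i - j ∣)  ≡⟨ cong (λ n → sumN n (λ j → ∣ i - j ∣)) (sym (+-suc i k)) ⟩
  sumN (i + suc k) (λ j → ∣ i - j ∣)    ≡⟨ sumN-∣-∣ i k ⟩
  tri i + tri k                        ≤⟨ m≤m+n _ (i * k) ⟩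
  tri i + tri k + i * k                ≡⟨ sym (tri-+ i k) ⟩
  tri (i + k)                          ∎
  where open ≤-Reasoning

isYes-× : ∀ {A B : Set} (a? : Dec A) (b? : Dec B) → ⌊ a? ⌋ ∧ ⌊ b? ⌋ ≡ ⌊ a? ×-dec b? ⌋
isYes-× (yes a) (yes b) = refl
isYes-× (yes a) (no ¬b) = refl
isYes-× (no ¬a) b?      = refl

count-≡ : ∀ n c → sumN n (λ y → bit ⌊ y ≟ c ⌋) ≡ bit ⌊ c <? n ⌋
count-≡ zero    c       = cong bit (sym (isYes-false (c <? 0) λ ()))
count-≡ (suc n) zero    = cong suc (trans (sumN-cong n (λ j _ → cong bit (isYes-false (suc j ≟ 0) λ ())))
                                           (trans (sumN-const n 0) (*-zeroʳ n)))
count-≡ (suc n) (suc c) = trans (sumN-cong n (λ j _ → cong bit (isYes-cong (suc j ≟ suc c) (j ≟ c) suc-injective (cong suc))))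
                                (trans (count-≡ n c) (cong bit (isYes-cong (c <? n) (suc c <? suc n) s≤s ≤-pred)))

count-< : ∀ n c → sumN n (λ x → bit ⌊ x <? c ⌋) ≡ n ⊓ c
count-< zero    c       = refl
count-< (suc n) zero    = trans (sumN-cong (suc n) (λ j _ → cong bit (isYes-false (j <? 0) λ ())))
                                (trans (sumN-const (suc n) 0) (*-zeroʳ (suc n)))
count-< (suc n) (suc c) = cong suc (trans (sumN-cong n (λ j _ → cong bit (isYes-cong (suc j <? suc c) (j <? c) ≤-pred s≤s))) (count-< n c))

edgeCount-fromRelation : ∀ n {R : ℕ → ℕ → Set} (R? : ∀ x y → Dec (R x y))
                         (R-sym : ∀ {x y} → R x y → R y x) (R-irrefl : ∀ {x} → ¬ R x x) →
  edgeCount (fromRelation n R? R-sym R-irrefl) ≡ sumN n (λ x → sumN n (λ y → bit (⌊ x <? y ⌋ ∧ ⌊ R? x y ⌋)))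
edgeCount-fromRelation n R? _ _ =
  trans (sumF-cong {n} (λ u → sumF-toℕ {n} (λ y → bit (⌊ toℕ u <? y ⌋ ∧ ⌊ R? (toℕ u) y ⌋))))
        (sumF-toℕ {n} (λ x → sumN n (λ y → bit (⌊ x <? y ⌋ ∧ ⌊ R? x y ⌋))))

-- Paths and a pendant caterpillar

PathAdj : ℕ → ℕ → Set
PathAdj x y = y ≡ suc x ⊎ x ≡ suc y

pathAdj? : ∀ x y → Dec (PathAdj x y)
pathAdj? x y = (y ≟ suc x) ⊎-dec (x ≟ suc y)

pathAdj-sym : ∀ {x y} → PathAdj x y → PathAdj y x
pathAdj-sym (inj₁ e) = inj₂ e
pathAdj-sym (inj₂ e) = inj₁ e

pathAdj-irrefl : ∀ {x} → ¬ PathAdj x x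
pathAdj-irrefl (inj₁ e) = 1+n≢n (sym e)
pathAdj-irrefl (inj₂ e) = 1+n≢n (sym e)

∣-∣-pathAdj : ∀ {x w} y → PathAdj x w → ∣ x - y ∣ ≤ suc ∣ w - y ∣
∣-∣-pathAdj {x} {w} y a = ≤-trans (∣-∣-triangle x w y) (+-monoˡ-≤ ∣ w - y ∣ (≤-reflexive (step a)))
  where
  step : ∀ {x w} → PathAdj x w → ∣ x - w ∣ ≡ 1
  step {x} (inj₁ refl) = trans (m≤n⇒∣m-n∣≡n∸m (n≤1+n x)) (m+n∸n≡m 1 x)
  step {w = w} (inj₂ refl) = trans (∣-∣-comm (suc w) w) (trans (m≤n⇒∣m-n∣≡n∸m (n≤1+n w)) (m+n∸n≡m 1 w))

∣-∣-step : ∀ x y {k} → ∣ x - y ∣ ≡ suc k → Σ ℕ λ w → PathAdj x w × ∣ w - y ∣ ≡ k × w ≤ x ⊔ y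
∣-∣-step zero    (suc y) refl = 1 , inj₁ refl , refl , s≤s z≤n
∣-∣-step (suc x) zero    refl = x , inj₂ refl , ∣-∣-identityʳ x , n≤1+n x
∣-∣-step (suc x) (suc y) e with ∣-∣-step x y e
... | w , inj₁ a , e′ , w≤ = suc w , inj₁ (cong suc a) , e′ , s≤s w≤
... | w , inj₂ a , e′ , w≤ = suc w , inj₂ (cong suc a) , e′ , s≤s w≤

path-forward-degree : ∀ n x → sumN n (λ y → bit (⌊ x <? y ⌋ ∧ ⌊ pathAdj? x y ⌋)) ≡ bit ⌊ suc x <? n ⌋
path-forward-degree n x = trans (sumN-cong n (λ y _ → cong bit (trans (isYes-× (x <? y) (pathAdj? x y))
                                                              (isYes-cong ((x <? y) ×-dec pathAdj? x y) (y ≟ suc x) successor forward))))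
                        (count-≡ n (suc x))
  where
  successor : ∀ {y} → x < y × PathAdj x y → y ≡ suc x
  successor (_   , inj₁ e) = e
  successor (x<y , inj₂ refl) = ⊥-elim (<-asym x<y ≤-refl)
  forward : ∀ {y} → y ≡ suc x → x < y × PathAdj x y
  forward refl = ≤-refl , inj₁ refl

one-end-far : ∀ {R K i} → i ≤ K → R + R ≤ suc K → R ≤ i ⊎ R ≤ K ∸ i
one-end-far {R} {K} {i} i≤K 2R≤ with R ≤? i | R ≤? K ∸ i
... | yes R≤i | _       = inj₁ R≤i
... | no _    | yes R≤  = inj₂ R≤
... | no R≰i  | no R≰   = ⊥-elim (1+n≰n (≤-trans (≤-reflexive split) (≤-trans (+-mono-≤ (≰⇒> R≰i) (≰⇒> R≰)) 2R≤)))
  where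
  split : suc (suc K) ≡ suc i + suc (K ∸ i)
  split = sym (trans (cong suc (+-suc i (K ∸ i))) (cong (λ z → suc (suc z)) (m+[n∸m]≡n i≤K)))

module Path (N : ℕ) where

  metric-step : ∀ {x y k} → x < suc N → y < suc N → ∣ x - y ∣ ≡ suc k → Σ ℕ λ w → w < suc N × PathAdj x w × ∣ w - y ∣ ≡ k
  metric-step {x} {y} x<n y<n e with ∣-∣-step x y e
  ... | w , a , e′ , w≤ = w , ≤-<-trans w≤ (⊔-lub x<n y<n) , a , e′

  metric-bound : ∀ {x y} → x < suc N → y < suc N → ∣ x - y ∣ ≤ suc N
  metric-bound {x} {y} x<n y<n = <⇒≤ (≤-<-trans (∣m-n∣≤m⊔n x y) (⊔-lub x<n y<n))

  open GraphMetric pathAdj? pathAdj-sym pathAdj-irrefl (λ x y → ∣ x - y ∣)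
                   ∣m-n∣≡0⇒m≡n ∣n-n∣≡0 ∣-∣-pathAdj metric-step metric-bound public

  dist≤N : ∀ u v → dist G u v ≤ N
  dist≤N u v = subst (_≤ N) (sym (dist≡metric u v)) (≤-trans (∣m-n∣≤m⊔n (toℕ u) (toℕ v)) (⊔-lub (toℕ≤pred[n] u) (toℕ≤pred[n] v)))

  transmission≤ : ∀ v → transmission G v ≤ tri N
  transmission≤ v = subst (_≤ tri N) (sym (trans (sumF-cong (dist≡metric v)) (sumF-toℕ {suc N} (λ j → ∣ toℕ v - j ∣))))
                          (sumN-∣-∣≤tri (toℕ≤pred[n] v))

  ecc≥ends : ∀ v → toℕ v ≤ ecc G v × N ∸ toℕ v ≤ ecc G v
  ecc≥ends v = subst (_≤ ecc G v) (trans (dist≡metric v zero) (∣-∣-identityʳ (toℕ v))) (maxF-ub (dist G v) zero)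
             , subst (_≤ ecc G v) (trans (dist≡metric v (fromℕ N))
                                         (trans (cong (λ z → ∣ toℕ v - z ∣) (toℕ-fromℕ N)) (m≤n⇒∣m-n∣≡n∸m (toℕ≤pred[n] v))))
                 (maxF-ub (dist G v) (fromℕ N))

  radius≥ : ∀ R → R + R ≤ suc N → R ≤ radius G
  radius≥ R 2R≤n = minF-glb (ecc G) R far
    where
    far : ∀ v → R ≤ ecc G v
    far v with one-end-far (toℕ≤pred[n] v) 2R≤n
    ... | inj₁ R≤v   = ≤-trans R≤v (proj₁ (ecc≥ends v))
    ... | inj₂ R≤N-v = ≤-trans R≤N-v (proj₂ (ecc≥ends v))

  edges : edgeCount G ≡ N
  edges = trans (edgeCount-fromRelation (suc N) pathAdj? pathAdj-sym pathAdj-irrefl)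
            (trans (sumN-cong (suc N) (λ x _ → trans (path-forward-degree (suc N) x)
                                                      (cong bit (isYes-cong (suc x <? suc N) (x <? N) ≤-pred s≤s))))
              (trans (count-< (suc N) N) (m≥n⇒m⊓n≡n (n≤1+n N))))

  diameter≡N : diameter G ≡ N
  diameter≡N = ≤-antisym (maxF-lub (ecc G) N (λ v → maxF-lub (dist G v) N (dist≤N v)))
                 (≤-trans (≤-reflexive (sym (trans (dist≡metric zero (fromℕ N)) (toℕ-fromℕ N))))
                   (≤-trans (maxF-ub (dist G zero) (fromℕ N)) (maxF-ub (ecc G) zero)))

  isCaterpillar : IsCaterpillar G
  isCaterpillar = (connected , edges) , N , (λ i → i) , ((λ e → e) , consecutive) , sym diameter≡N , (λ v → inj₁ (v , refl))
    where
    consecutive : ∀ (i : Fin N) → adj G (inject₁ i) (suc i) ≡ true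
    consecutive i = isYes-true (pathAdj? _ _) (inj₁ (cong suc (sym (toℕ-inject₁ i))))

∣-∣≤1+half : ∀ {i b} → i ≤ suc (b + b) → ∣ i - b ∣ ≤ suc b
∣-∣≤1+half {i} {b} i≤ with ≤-total i b
... | inj₁ i≤b = subst (_≤ suc b) (sym (m≤n⇒∣m-n∣≡n∸m i≤b)) (≤-trans (m∸n≤m b i) (n≤1+n b))
... | inj₂ b≤i = subst (_≤ suc b) (sym (m≤n⇒∣n-m∣≡n∸m b≤i)) (subst (i ∸ b ≤_) (m+n∸n≡m (suc b) b) (∸-monoˡ-≤ b i≤))

-- Vertex 0 hangs off spine vertex 1 + b of the path 1, 2, …, 2b + 2.
module PendantPath (b : ℕ) where

  P : ℕ
  P = suc (suc (b + b))

  b<P : b < P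
  b<P = s≤s (≤-trans (m≤m+n b b) (n≤1+n _))

  Adj : ℕ → ℕ → Set
  Adj zero    zero    = ⊥
  Adj zero    (suc y) = y ≡ b
  Adj (suc x) zero    = x ≡ b
  Adj (suc x) (suc y) = PathAdj x y

  adj? : ∀ x y → Dec (Adj x y)
  adj? zero    zero    = no λ ()
  adj? zero    (suc y) = y ≟ b
  adj? (suc x) zero    = x ≟ b
  adj? (suc x) (suc y) = pathAdj? x y

  adj-sym : ∀ {x y} → Adj x y → Adj y x
  adj-sym {zero}  {suc y} e = e
  adj-sym {suc x} {zero}  e = e
  adj-sym {suc x} {suc y} a = pathAdj-sym a

  adj-irrefl : ∀ {x} → ¬ Adj x x
  adj-irrefl {zero}  ()
  adj-irrefl {suc x} a = pathAdj-irrefl a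

  metric : ℕ → ℕ → ℕ
  metric zero    zero    = 0
  metric zero    (suc y) = suc ∣ b - y ∣
  metric (suc x) zero    = suc ∣ x - b ∣
  metric (suc x) (suc y) = ∣ x - y ∣

  metric≡0⇒≡ : ∀ {x y} → metric x y ≡ 0 → x ≡ y
  metric≡0⇒≡ {zero}  {zero}  _ = refl
  metric≡0⇒≡ {suc x} {suc y} e = cong suc (∣m-n∣≡0⇒m≡n e)

  metric-refl : ∀ x → metric x x ≡ 0
  metric-refl zero    = refl
  metric-refl (suc x) = ∣n-n∣≡0 x

  metric-adj : ∀ {x w} y → Adj x w → metric x y ≤ suc (metric w y)
  metric-adj {zero}  {suc w} zero    _    = z≤n
  metric-adj {zero}  {suc w} (suc y) refl = ≤-refl
  metric-adj {suc x} {zero}  zero    refl = ≤-reflexive (cong suc (∣n-n∣≡0 x))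
  metric-adj {suc x} {zero}  (suc y) refl = ≤-trans (n≤1+n _) (n≤1+n _)
  metric-adj {suc x} {suc w} zero    a    = s≤s (∣-∣-pathAdj b a)
  metric-adj {suc x} {suc w} (suc y) a    = ∣-∣-pathAdj y a

  metric-step : ∀ {x y k} → x < suc P → y < suc P → metric x y ≡ suc k → Σ ℕ λ w → w < suc P × Adj x w × metric w y ≡ k
  metric-step {zero}  {suc y} _ _ refl = suc b , s≤s b<P , refl , refl
  metric-step {suc x} {zero}  {k} (s≤s x<P) _ e = toward-hub ∣ x - b ∣ refl (suc-injective e)
    where
    toward-hub : ∀ j → ∣ x - b ∣ ≡ j → j ≡ k → Σ ℕ λ w → w < suc P × Adj (suc x) w × metric w zero ≡ k
    toward-hub zero    d refl = zero , s≤s z≤n , ∣m-n∣≡0⇒m≡n d , refl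
    toward-hub (suc j) d refl with ∣-∣-step x b d
    ... | w , a , e′ , w≤ = suc w , s≤s (≤-<-trans w≤ (⊔-lub x<P b<P)) , a , cong suc e′
  metric-step {suc x} {suc y} (s≤s x<P) (s≤s y<P) e with ∣-∣-step x y e
  ... | w , a , e′ , w≤ = suc w , s≤s (≤-<-trans w≤ (⊔-lub x<P y<P)) , a , e′

  metric-bound : ∀ {x y} → x < suc P → y < suc P → metric x y ≤ suc P
  metric-bound {zero}  {zero}  _         _         = z≤n
  metric-bound {zero}  {suc y} _         (s≤s y<P) = s≤s (<⇒≤ (≤-<-trans (∣m-n∣≤m⊔n b y) (⊔-lub b<P y<P)))
  metric-bound {suc x} {zero}  (s≤s x<P) _         = s≤s (<⇒≤ (≤-<-trans (∣m-n∣≤m⊔n x b) (⊔-lub x<P b<P)))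
  metric-bound {suc x} {suc y} (s≤s x<P) (s≤s y<P) = ≤-trans (<⇒≤ (≤-<-trans (∣m-n∣≤m⊔n x y) (⊔-lub x<P y<P))) (n≤1+n P)

  open GraphMetric adj? adj-sym adj-irrefl metric metric≡0⇒≡ metric-refl metric-adj metric-step metric-bound public

  transmission≡ : ∀ v → transmission G v ≡ sumN (suc P) (metric (toℕ v))
  transmission≡ v = trans (sumF-cong (dist≡metric v)) (sumF-toℕ {suc P} (metric (toℕ v)))

  hub-transmission : sumN (suc P) (metric zero) ≡ P + (tri b + tri (suc b))
  hub-transmission = trans (sumN-suc P (λ j → ∣ b - j ∣))
    (cong (P +_) (subst (λ n → sumN n (λ j → ∣ b - j ∣) ≡ tri b + tri (suc b)) P≡ (sumN-∣-∣ b (suc b))))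
    where
    P≡ : b + suc (suc b) ≡ P
    P≡ = trans (+-suc b (suc b)) (cong suc (+-suc b b))

  transmission≤ : ∀ v → transmission G v ≤ P * suc b + 1
  transmission≤ v = subst (_≤ P * suc b + 1) (sym (transmission≡ v)) (row (toℕ v) (toℕ<n v))
    where
    row : ∀ x → x < suc P → sumN (suc P) (metric x) ≤ P * suc b + 1
    row zero    _ = begin
      sumN (suc P) (metric zero)                    ≡⟨ hub-transmission ⟩
      P + (tri b + (suc b + tri b))            ≡⟨ regroup b (tri b) ⟩
      tri b + tri b + 3 * suc b                ≤⟨ m≤m+n _ (b * b) ⟩
      tri b + tri b + 3 * suc b + b * b        ≡⟨ cong (λ t → t + 3 * suc b + b * b) (tri-double b) ⟩
      b * suc b + 3 * suc b + b * b            ≡⟨ expand b ⟩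
      P * suc b + 1                            ∎
      where
      open ≤-Reasoning
      regroup : ∀ b t → suc (suc (b + b)) + (t + (suc b + t)) ≡ t + t + 3 * suc b
      regroup = solve-∀
      expand : ∀ b → b * suc b + 3 * suc b + b * b ≡ suc (suc (b + b)) * suc b + 1
      expand = solve-∀
    row (suc i) (s≤s i<P) = begin
      suc ∣ i - b ∣ + sumN P (λ j → ∣ i - j ∣)   ≤⟨ +-mono-≤ (s≤s (∣-∣≤1+half (≤-pred i<P))) (sumN-∣-∣≤tri (≤-pred i<P)) ⟩
      suc (suc b) + tri (suc (b + b))          ≡⟨ cong (suc (suc b) +_) (tri-odd b) ⟩
      suc (suc b) + suc b * suc (b + b)        ≡⟨ expand b ⟩
      P * suc b + 1                            ∎
      where
      open ≤-Reasoning
      expand : ∀ b → suc (suc b) + suc b * suc (b + b) ≡ suc (suc (b + b)) * suc b + 1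
      expand = solve-∀

  last : Fin (suc P)
  last = fromℕ P

  radius≥ : suc b ≤ radius G
  radius≥ = minF-glb (ecc G) (suc b) far
    where
    toward : ∀ v w → metric (toℕ v) (toℕ w) ≤ ecc G v
    toward v w = subst (_≤ ecc G v) (dist≡metric v w) (maxF-ub (dist G v) w)
    far : ∀ v → suc b ≤ ecc G v
    far zero    = subst (_≤ ecc G zero) (cong suc (∣-∣-identityʳ b)) (toward zero (suc zero))
    far (suc v) with one-end-far (toℕ≤pred[n] v) (≤-reflexive (cong suc (+-suc b b)))
    ... | inj₁ b<v    = ≤-trans b<v (subst (_≤ ecc G (suc v)) (∣-∣-identityʳ (toℕ v)) (toward (suc v) (suc zero)))
    ... | inj₂ b<last = ≤-trans b<last (subst (_≤ ecc G (suc v))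
                          (trans (cong (λ z → metric (suc (toℕ v)) z) (toℕ-fromℕ P)) (m≤n⇒∣m-n∣≡n∸m (toℕ≤pred[n] v)))
                          (toward (suc v) last))

  edges : edgeCount G ≡ P
  edges = trans (edgeCount-fromRelation (suc P) adj? adj-sym adj-irrefl)
            (cong₂ _+_ hub-row (trans (sumN-cong P (λ x _ → spine-row x)) (trans (count-< P (suc (b + b))) (m≥n⇒m⊓n≡n (n≤1+n _)))))
    where
    hub-row : sumN (suc P) (λ y → bit (⌊ 0 <? y ⌋ ∧ ⌊ adj? 0 y ⌋)) ≡ 1
    hub-row = trans (sumN-cong P (λ y _ → cong bit (trans (isYes-× (0 <? suc y) (y ≟ b))
                      (isYes-cong ((0 <? suc y) ×-dec (y ≟ b)) (y ≟ b) proj₂ (λ e → s≤s z≤n , e)))))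
                (trans (count-≡ P b) (cong bit (isYes-true (b <? P) b<P)))
    spine-row : ∀ x → sumN (suc P) (λ y → bit (⌊ suc x <? y ⌋ ∧ ⌊ adj? (suc x) y ⌋)) ≡ bit ⌊ x <? suc (b + b) ⌋
    spine-row x rewrite isYes-false (suc x <? 0) (λ ()) =
      trans (sumN-cong P (λ y _ → cong (λ t → bit (t ∧ ⌊ pathAdj? x y ⌋)) (isYes-cong (suc x <? suc y) (x <? y) ≤-pred s≤s)))
        (trans (path-forward-degree P x) (cong bit (isYes-cong (suc x <? P) (x <? suc (b + b)) ≤-pred s≤s)))

  dist≤ : 1 ≤ b → ∀ u v → dist G u v ≤ suc (b + b)
  dist≤ 1≤b u v = subst (_≤ suc (b + b)) (sym (dist≡metric u v)) (bounded (toℕ u) (toℕ v) (toℕ<n u) (toℕ<n v))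
    where
    hub≤ : suc (suc b) ≤ suc (b + b)
    hub≤ = s≤s (+-monoˡ-≤ b 1≤b)
    bounded : ∀ x y → x < suc P → y < suc P → metric x y ≤ suc (b + b)
    bounded zero    zero    _         _         = z≤n
    bounded zero    (suc y) _         (s≤s y<P) = ≤-trans (s≤s (subst (_≤ suc b) (∣-∣-comm y b) (∣-∣≤1+half (≤-pred y<P)))) hub≤
    bounded (suc x) zero    (s≤s x<P) _         = ≤-trans (s≤s (∣-∣≤1+half (≤-pred x<P))) hub≤
    bounded (suc x) (suc y) (s≤s x<P) (s≤s y<P) = ≤-trans (∣m-n∣≤m⊔n x y) (⊔-lub (≤-pred x<P) (≤-pred y<P))

  diameter≡ : 1 ≤ b → diameter G ≡ suc (b + b)
  diameter≡ 1≤b = ≤-antisym (maxF-lub (ecc G) _ (λ v → maxF-lub (dist G v) _ (dist≤ 1≤b v)))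
    (≤-trans (≤-reflexive (sym (trans (dist≡metric (suc zero) last) (cong (metric 1) (toℕ-fromℕ P)))))
      (≤-trans (maxF-ub (dist G (suc zero)) last) (maxF-ub (ecc G) (suc zero))))

  isCaterpillar : 1 ≤ b → IsCaterpillar G
  isCaterpillar 1≤b = (connected , edges) , suc (b + b) , suc , (Fin.suc-injective , consecutive) , sym (diameter≡ 1≤b) , covered
    where
    consecutive : ∀ (i : Fin (suc (b + b))) → adj G (suc (inject₁ i)) (suc (suc i)) ≡ true
    consecutive i = isYes-true (pathAdj? _ _) (inj₁ (cong suc (sym (toℕ-inject₁ i))))
    covered : ∀ v → (Σ (Fin P) λ i → suc i ≡ v) ⊎ (Σ (Fin P) λ i → adj G v (suc i) ≡ true)
    covered zero    = inj₂ (fromℕ< b<P , isYes-true (toℕ (fromℕ< b<P) ≟ b) (toℕ-fromℕ< b<P))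
    covered (suc w) = inj₁ (w , refl)

-- Remoteness minus radius

ratio : ℕ → ℕ → ℚ
ratio a m = ℤ.+ a ℚ./ suc m

ratio≃ : ∀ a m → toℚᵘ (ratio a m) ℚᵘ.≃ ℚᵘ.mkℚᵘ (ℤ.+ a) m
ratio≃ a m = ℚ.toℚᵘ-fromℚᵘ (ℚᵘ.mkℚᵘ (ℤ.+ a) m)

ratio-mono : ∀ m {a b} → a ≤ b → ratio a m ℚ.≤ ratio b m
ratio-mono m {a} {b} a≤b =
  ℚ.toℚᵘ-cancel-≤ (ℚᵘ.≤-respˡ-≃ (ℚᵘ.≃-sym (ratio≃ a m)) (ℚᵘ.≤-respʳ-≃ (ℚᵘ.≃-sym (ratio≃ b m))
    (ℚᵘ.*≤* (subst₂ ℤ._≤_ (ℤ.pos-* a (suc m)) (ℤ.pos-* b (suc m)) (ℤ.+≤+ (*-monoˡ-≤ (suc m) a≤b))))))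

ratio-split : ∀ m x δ → ratio (suc m * x + δ) m ≡ ratio x 0 ℚ.+ ratio δ m
ratio-split m x δ = ℚ.toℚᵘ-injective (ℚᵘ.≃-trans (ratio≃ (suc m * x + δ) m) (ℚᵘ.≃-trans cross-multiplied
  (ℚᵘ.≃-sym (ℚᵘ.≃-trans (ℚ.toℚᵘ-homo-+ (ratio x 0) (ratio δ m)) (ℚᵘ.+-cong (ratio≃ x 0) (ratio≃ δ m))))))
  where
  expand : ∀ m x δ → (suc m * x + δ) * suc (m + 0) ≡ (x * suc m + δ * 1) * suc m
  expand = solve-∀
  cross-multiplied : ℚᵘ.mkℚᵘ (ℤ.+ (suc m * x + δ)) m ℚᵘ.≃ ℚᵘ.mkℚᵘ (ℤ.+ x) 0 ℚᵘ.+ ℚᵘ.mkℚᵘ (ℤ.+ δ) m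
  cross-multiplied = ℚᵘ.*≡* (trans (sym (ℤ.pos-* (suc m * x + δ) (suc (m + 0))))
    (trans (cong ℤ.+_ (expand m x δ))
      (trans (ℤ.pos-* (x * suc m + δ * 1) (suc m))
        (cong (ℤ._* ℤ.+ suc m) (trans (ℤ.pos-+ (x * suc m) (δ * 1)) (cong₂ ℤ._+_ (ℤ.pos-* x (suc m)) (ℤ.pos-* δ 1)))))))

+-sub-cancelˡ : ∀ a b → (a ℚ.+ b) ℚ.- a ≡ b
+-sub-cancelˡ a b = trans (cong (ℚ._+ ℚ.- a) (ℚ.+-comm a b))
  (trans (ℚ.+-assoc b a (ℚ.- a)) (trans (cong (b ℚ.+_) (ℚ.+-inverseʳ a)) (ℚ.+-identityʳ b)))

excess≤ : ∀ m {ρ R r δ} → ρ ℚ.≤ ratio (suc m * R + δ) m → R ≤ r → ρ ℚ.- ratio r 0 ℚ.≤ ratio δ m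
excess≤ m {ρ} {R} {r} {δ} ρ≤ R≤r = begin
  ρ ℚ.- ratio r 0                          ≤⟨ ℚ.+-mono-≤ ρ≤ (ℚ.neg-antimono-≤ (ratio-mono 0 R≤r)) ⟩
  ratio (suc m * R + δ) m ℚ.- ratio R 0    ≡⟨ cong (ℚ._- ratio R 0) (ratio-split m R δ) ⟩
  (ratio R 0 ℚ.+ ratio δ m) ℚ.- ratio R 0  ≡⟨ +-sub-cancelˡ (ratio R 0) (ratio δ m) ⟩
  ratio δ m                                ∎
  where open ℚ.≤-Reasoning

excess≥ : ∀ m {ρ r δ} → ratio (suc m * r + δ) m ℚ.≤ ρ → ratio δ m ℚ.≤ ρ ℚ.- ratio r 0
excess≥ m {ρ} {r} {δ} ≤ρ = begin
  ratio δ m                                ≡⟨ sym (+-sub-cancelˡ (ratio r 0) (ratio δ m)) ⟩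
  (ratio r 0 ℚ.+ ratio δ m) ℚ.- ratio r 0  ≡⟨ cong (ℚ._- ratio r 0) (sym (ratio-split m r δ)) ⟩
  ratio (suc m * r + δ) m ℚ.- ratio r 0    ≤⟨ ℚ.+-monoˡ-≤ (ℚ.- ratio r 0) ≤ρ ⟩
  ρ ℚ.- ratio r 0                          ∎
  where open ℚ.≤-Reasoning

remoteness≤ : ∀ {m} (G : Graph (suc (suc m))) t → (∀ v → transmission G v ≤ t) → remoteness G ℚ.≤ ratio t m
remoteness≤ {m} G t bound = maxQ-lub (normTrans G) (ratio t m) (λ v → ratio-mono m (bound v))

transmission≤remoteness : ∀ {m} (G : Graph (suc (suc m))) v → ratio (transmission G v) m ℚ.≤ remoteness G
transmission≤remoteness G v = maxQ-ub (normTrans G) v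

-- For odd n ≥ 5 the path fails: its ends have transmission (m + 1)R + R. Moving one end to the middle fixes this.
caterpillar-upper-bound : ∀ m → Σ (Graph (suc (suc m))) λ G′ → IsCaterpillar G′ ×
                          Σ ℕ λ R → R ≤ radius G′ × (∀ v → transmission G′ v ≤ suc m * R + bit (even (suc m)))
caterpillar-upper-bound m with halve m
... | a , inj₁ refl =
  Path.G N , Path.isCaterpillar N , suc a , Path.radius≥ N (suc a) (≤-reflexive (cong suc (+-suc a a))) , bound
  where
  N = suc (a + a)
  bound : ∀ v → transmission (Path.G N) v ≤ N * suc a + bit (even N)
  bound v = ≤-trans (Path.transmission≤ N v) (≤-trans (≤-reflexive (trans (tri-odd a) (*-comm (suc a) N))) (m≤m+n _ _))
... | zero , inj₂ refl = Path.G 2 , Path.isCaterpillar 2 , 1 , Path.radius≥ 2 1 (s≤s (s≤s z≤n)) , Path.transmission≤ 2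
... | suc a′ , inj₂ refl =
  PendantPath.G a , PendantPath.isCaterpillar a (s≤s z≤n) , suc a , PendantPath.radius≥ a , bound
  where
  a = suc a′
  bound : ∀ v → transmission (PendantPath.G a) v ≤ PendantPath.P a * suc a + bit (even (a + a))
  bound v rewrite even-double a = PendantPath.transmission≤ a v

excess-comparison : ∀ {m δ} (G′ G : Graph (suc (suc m))) R v → R ≤ radius G′ →
                    (∀ w → transmission G′ w ≤ suc m * R + δ) → suc m * radius G + δ ≤ transmission G v →
                    remoteness G′ ℚ.- ratio (radius G′) 0 ℚ.≤ remoteness G ℚ.- ratio (radius G) 0
excess-comparison {m} {δ} G′ G R v R≤r′ upper lower =
  ℚ.≤-trans (excess≤ m {R = R} {δ = δ} (remoteness≤ G′ (suc m * R + δ) upper) R≤r′)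
            (excess≥ m {r = radius G} {δ = δ} (ℚ.≤-trans (ratio-mono m lower) (transmission≤remoteness G v)))

lemma13 : (m : ℕ) (G : Graph (suc (suc m))) → IsTree G →
    Σ (Graph (suc (suc m))) λ G' → IsCaterpillar G' ×
    (remoteness G' ℚ.- (ℤ.+ radius G' ℚ./ 1)) ℚ.≤ (remoteness G ℚ.- (ℤ.+ radius G ℚ./ 1))
lemma13 m G tree =
  let G′ , caterpillar , R , R≤r′ , upper = caterpillar-upper-bound m
      v , lower = transmission-lower-bound m G tree
  in  G′ , caterpillar , excess-comparison G′ G R v R≤r′ upper lower
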